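{- Let $G$ and $H$ be graphs and $k\ge 2$ an integer. Then $$\gamma_{k{\rm rt}}(G)\cdot\gamma_{k{\rm rt}}(H)\le 2k\cdot\gamma_{k{\rm rt}}(G\,\square\,H)\quad\text{and}\quad \gamma_{{\rm r}k}(G)\cdot\gamma_{{\rm r}k}(H)\le 2k\cdot\gamma_{{\rm r}k}(G\,\square\,H).$$
   Context: All graphs are finite, simple and undirected (with at least one vertex); $N(v)$ denotes the open neighborhood of $v$, and $[k]=\{1,\dots,k\}$. $G\,\square\,H$ is the Cartesian product: vertex set $V(G)\times V(H)$, with $(g,h)$ adjacent to $(g',h')$ iff either $g=g'$ and $hh'\in E(H)$, or $h=h'$ and $gg'\in E(G)$. A $k$-rainbow dominating function ($k$RDF) of $G$ is a function $f:V(G)\to 2^{[k]}$ such that every vertex $v$ with $f(v)=\emptyset$ satisfies $\bigcup_{u\in N(v)}f(u)=[k]$. A $k$-rainbow total dominating function ($k$RTDF) is a $k$RDF $f$ such that additionally, for every vertex $v$ with $f(v)=\{i\}$ for some $i\in[k]$, there is $u\in N(v)$ with $i\in f(u)$. The weight of $f$ is $\sum_v|f(v)|$; $\gamma_{{\rm r}k}(G)$ and $\gamma_{k{\rm rt}}(G)$ are the minimum weights of a $k$RDF and a $k$RTDF of $G$, respectively. -}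

module Defs where

open import Data.Nat using (ℕ; suc; _+_; _≤_)
open import Data.Fin using (Fin; remQuot)
open import Data.Fin.Subset using (Subset; ⊥; ⁅_⁆; _∈_; ∣_∣)
open import Data.Product using (Σ; ∃; _×_; _,_; proj₁; proj₂)
open import Data.Sum using (_⊎_)
open import Data.Empty renaming (⊥ to Empty)
open import Relation.Nullary using (¬_)
open import Relation.Binary.PropositionalEquality using (_≡_)

AdjRel : ℕ → Set₁
AdjRel n = Fin n → Fin n → Set

record Graph : Set₁ where
  field
    n'    : ℕ
    Adj   : AdjRel (suc n')
    sym   : ∀ {u v} → Adj u v → Adj v u
    irref : ∀ {v} → ¬ Adj v v

  n : ℕ
  n = suc n'

open Graph public

-- Cartesian product G □ H on vertex set Fin (|G| * |H|), where a vertex x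
-- is identified with the pair remQuot x = (g , h) (a bijection Fin (m*n) ≅ Fin m × Fin n).
□Adj : (G H : Graph) → AdjRel (n G Data.Nat.* n H)
□Adj G H x y with remQuot (n H) x | remQuot (n H) y
... | (g , h) | (g' , h') = (g ≡ g' × Adj H h h') ⊎ (h ≡ h' × Adj G g g')

weight : ∀ {n k} → (Fin n → Subset k) → ℕ
weight {ℕ.zero}  f = 0
weight {suc n}   f = ∣ f Fin.zero ∣ + weight (λ i → f (Fin.suc i))

IsKRDF : ∀ {n} (A : AdjRel n) (k : ℕ) → (Fin n → Subset k) → Set
IsKRDF A k f = ∀ v → f v ≡ ⊥ → ∀ (i : Fin k) → ∃ λ u → A v u × i ∈ f u

IsKRTDF : ∀ {n} (A : AdjRel n) (k : ℕ) → (Fin n → Subset k) → Set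
IsKRTDF A k f = IsKRDF A k f
  × (∀ v (i : Fin k) → f v ≡ ⁅ i ⁆ → ∃ λ u → A v u × i ∈ f u)

IsMinWeight : ∀ {n k} → ((Fin n → Subset k) → Set) → ℕ → Set
IsMinWeight {n} {k} P γ =
  (Σ (Fin n → Subset k) λ f → P f × weight f ≡ γ)
  × (∀ f → P f → γ ≤ weight f)

IsRainbowDomNum : ∀ {n} (A : AdjRel n) (k : ℕ) → ℕ → Set
IsRainbowDomNum A k = IsMinWeight (IsKRDF A k)

IsRainbowTotalDomNum : ∀ {n} (A : AdjRel n) (k : ℕ) → ℕ → Set
IsRainbowTotalDomNum A k = IsMinWeight (IsKRTDF A k)

module Submission where

-- Let α be a minimum k-rainbow (total) dominating function of G, of weight a, and f a minimum
-- one of G □ H, of weight c (only its kRDF property is used).  Fix for every vertex g of G and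
-- colour j' a *witness* π(g,j') = (x,j) with j ∈ α(x): either x = g (with j ≠ j' in the total
-- case) or x ~ g and j = j'.  Colour l is *seen* at (g,h) if f puts it on the closed
-- G-neighbourhood of (g,h); (h,l) is *bad* for (x,j) if some (g,j') ↦ (x,j) does not see l at (g,h).
--   β(h,l)(g) = [k] if l ∈ f(g,h), else {j ∈ α(g) : (h,l) bad for (g,j)}, is a kR(T)DF of G;
--   ψ(x,j)(h) = {l ∈ f(g,h) : (g,j') ↦ (x,j)} ∪ {l : (h, σ l) not bad for (x,j)} is a kRTDF of H,
-- σ a fixed-point-free rotation of the colours.  Summing w(β) ≥ a and w(ψ) ≥ b gives
-- |V(H)|·k·a ≤ k·c + T₁ and a·b ≤ k·c + T₂ with T₁ + T₂ = |V(H)|·k·a, whence a·b ≤ 2k·c.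

open import Defs
open import Data.Nat using (ℕ; zero; suc; _+_; _*_; _≤_; _≤?_; z≤n; s≤s; 2+)
open import Data.Nat.Properties
  using (+-*-semiring; +-assoc; +-comm; +-identityʳ; *-identityˡ; +-mono-≤; *-monoʳ-≤;
         ≤-refl; ≤-reflexive; ≤-trans; +-monoˡ-≤; +-cancelʳ-≤; module ≤-Reasoning)
open import Data.Nat.Tactic.RingSolver using (solve-∀)
open import Algebra.Properties.Semiring.Sum +-*-semiring
  using (sum; sum-syntax; sum-cong-≗; sum-replicate-zero; ∑-distrib-+; ∑-comm;
         *-distribˡ-sum; *-distribʳ-sum; sum-init-last)
open import Data.Bool using (Bool; true; false; _∧_; _∨_; not)
open import Data.Bool.Properties
  using (∧-assoc; ∨-zeroʳ; ∨-conicalˡ; ∨-conicalʳ; ∧-conicalˡ; ∧-conicalʳ; not-injective; ¬-not)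
open import Data.Fin using (Fin; zero; suc; combine; remQuot; _↑ˡ_; _↑ʳ_; fromℕ; inject₁)
open import Data.Fin.Properties using (_≟_; any?; suc-injective; remQuot-combine; combine-remQuot)
open import Data.Fin.Relation.Unary.Top using (view; ‵fromℕ; ‵inj₁)
open import Data.Fin.Subset using (Subset; ⁅_⁆; _∈_; _∉_; ∣_∣) renaming (⊥ to ∅)
open import Data.Fin.Subset.Properties
  using (_∈?_; nonempty?; Empty-unique; ∉⊥; x∈⁅x⁆; x∈⁅y⁆⇒x≡y; ⊆-antisym)
open import Data.Vec using ([]; _∷_; lookup; tabulate)
open import Data.Vec.Properties using (lookup∘tabulate; []=⇒lookup; lookup⇒[]=)
open import Data.Product using (_×_; _,_; proj₁; proj₂; ∃; uncurry)
open import Data.Sum using (_⊎_; inj₁; inj₂)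
open import Data.Unit using (⊤; tt)
open import Data.Empty using (⊥-elim)
open import Function using (_∘_)
open import Relation.Nullary using (Dec; yes; no; does; ¬_; ¬?)
open import Relation.Nullary.Decidable using (_×-dec_; dec-true; decidable-stable; ¬¬-excluded-middle)
open import Relation.Binary.PropositionalEquality
  using (_≡_; _≢_; refl; trans; cong; cong₂; subst; module ≡-Reasoning)
import Relation.Binary.PropositionalEquality as ≡

sum-mono : ∀ {n} {F G : Fin n → ℕ} → (∀ i → F i ≤ G i) → sum F ≤ sum G
sum-mono {zero}  F≤G = z≤n
sum-mono {suc n} F≤G = +-mono-≤ (F≤G zero) (sum-mono (F≤G ∘ suc))

sum-const : ∀ n c → ∑[ i < n ] c ≡ n * c
sum-const zero    c = refl
sum-const (suc n) c = cong (c +_) (sum-const n c)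

sum-++ : ∀ m n (F : Fin (m + n) → ℕ) → sum F ≡ ∑[ i < m ] F (i ↑ˡ n) + ∑[ j < n ] F (m ↑ʳ j)
sum-++ zero    n F = refl
sum-++ (suc m) n F = trans (cong (F zero +_) (sum-++ m n (F ∘ suc))) (≡.sym (+-assoc (F zero) _ _))

sum-combine : ∀ m n (F : Fin (m * n) → ℕ) → sum F ≡ ∑[ i < m ] ∑[ j < n ] F (combine i j)
sum-combine zero    n F = refl
sum-combine (suc m) n F =
  trans (sum-++ n (m * n) F)
        (cong (∑[ j < n ] F (combine (zero {m}) j) +_) (sum-combine m n (λ x → F (n ↑ʳ x))))

∑∑ : ∀ m n → (Fin m → Fin n → ℕ) → ℕ
∑∑ m n F = ∑[ i < m ] ∑[ j < n ] F i j

syntax ∑∑ m n (λ i j → x) = ∑[ i < m , j < n ] x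

∑∑-cong : ∀ {m n} {F G : Fin m → Fin n → ℕ} → (∀ i j → F i j ≡ G i j) → ∑∑ m n F ≡ ∑∑ m n G
∑∑-cong F≡G = sum-cong-≗ (λ i → sum-cong-≗ (F≡G i))

∑∑-mono : ∀ {m n} {F G : Fin m → Fin n → ℕ} → (∀ i j → F i j ≤ G i j) → ∑∑ m n F ≤ ∑∑ m n G
∑∑-mono F≤G = sum-mono (λ i → sum-mono (F≤G i))

∑∑-distrib-+ : ∀ {m n} (F G : Fin m → Fin n → ℕ) →
  ∑[ i < m , j < n ] (F i j + G i j) ≡ ∑∑ m n F + ∑∑ m n G
∑∑-distrib-+ F G =
  trans (sum-cong-≗ (λ i → ∑-distrib-+ (F i) (G i))) (∑-distrib-+ (sum ∘ F) (sum ∘ G))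

∑∑-distribˡ : ∀ {m n} c (F : Fin m → Fin n → ℕ) → c * ∑∑ m n F ≡ ∑[ i < m , j < n ] (c * F i j)
∑∑-distribˡ c F = trans (*-distribˡ-sum c (sum ∘ F)) (sum-cong-≗ (λ i → *-distribˡ-sum c (F i)))

∑∑-distribʳ : ∀ {m n} c (F : Fin m → Fin n → ℕ) → ∑∑ m n F * c ≡ ∑[ i < m , j < n ] (F i j * c)
∑∑-distribʳ c F = trans (*-distribʳ-sum c (sum ∘ F)) (sum-cong-≗ (λ i → *-distribʳ-sum c (F i)))

∑∑-const : ∀ m n c → ∑[ i < m , j < n ] c ≡ m * (n * c)
∑∑-const m n c = trans (sum-cong-≗ {m} (λ _ → sum-const n c)) (sum-const m (n * c))

∑∑-comm : ∀ {m n p q} (F : Fin m → Fin n → Fin p → Fin q → ℕ) →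
  ∑[ i < m , j < n ] ∑∑ p q (F i j) ≡ ∑[ a < p , b < q ] ∑[ i < m , j < n ] F i j a b
∑∑-comm {m} {n} {p} {q} F = begin
  ∑[ i < m ] ∑[ j < n ] ∑[ a < p ] ∑[ b < q ] F i j a b
    ≡⟨ sum-cong-≗ (λ i → ∑-comm (λ j a → ∑[ b < q ] F i j a b)) ⟩
  ∑[ i < m ] ∑[ a < p ] ∑[ j < n ] ∑[ b < q ] F i j a b
    ≡⟨ sum-cong-≗ (λ i → sum-cong-≗ (λ a → ∑-comm (λ j b → F i j a b))) ⟩
  ∑[ i < m ] ∑[ a < p ] ∑[ b < q ] ∑[ j < n ] F i j a b
    ≡⟨ ∑-comm (λ i a → ∑[ b < q ] ∑[ j < n ] F i j a b) ⟩
  ∑[ a < p ] ∑[ i < m ] ∑[ b < q ] ∑[ j < n ] F i j a b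
    ≡⟨ sum-cong-≗ (λ a → ∑-comm (λ i b → ∑[ j < n ] F i j a b)) ⟩
  ∑[ a < p ] ∑[ b < q ] ∑[ i < m ] ∑[ j < n ] F i j a b ∎
  where open ≡-Reasoning

⟦_⟧ : Bool → ℕ
⟦ true  ⟧ = 1
⟦ false ⟧ = 0

⟦∨⟧≤ : ∀ a b → ⟦ a ∨ b ⟧ ≤ ⟦ a ⟧ + ⟦ b ⟧
⟦∨⟧≤ true  true  = s≤s z≤n
⟦∨⟧≤ true  false = ≤-refl
⟦∨⟧≤ false b     = ≤-refl

⟦∧⟧ : ∀ a b → ⟦ a ∧ b ⟧ ≡ ⟦ a ⟧ * ⟦ b ⟧
⟦∧⟧ true  b = ≡.sym (+-identityʳ ⟦ b ⟧)
⟦∧⟧ false b = refl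

bit-clash : ∀ {b} → b ≡ true → ¬ (b ≡ false)
bit-clash refl ()

∨-trueˡ : ∀ {a} b → a ≡ true → a ∨ b ≡ true
∨-trueˡ b refl = refl

∨-trueʳ : ∀ a {b} → b ≡ true → a ∨ b ≡ true
∨-trueʳ a refl = ∨-zeroʳ a

⟦∧⟧-split : ∀ a b → ⟦ a ∧ b ⟧ + ⟦ a ∧ not b ⟧ ≡ ⟦ a ⟧
⟦∧⟧-split true  true  = refl
⟦∧⟧-split true  false = refl
⟦∧⟧-split false b     = refl

⟦⟧*-absorb : ∀ a p q → ⟦ a ⟧ * (p + q) ≤ p + ⟦ a ⟧ * q
⟦⟧*-absorb true  p q = ≤-reflexive (trans (*-identityˡ (p + q)) (cong (p +_) (≡.sym (*-identityˡ q))))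
⟦⟧*-absorb false p q = z≤n

any : ∀ n → (Fin n → Bool) → Bool
any zero    P = false
any (suc n) P = P zero ∨ any n (P ∘ suc)

any-witness : ∀ n (P : Fin n → Bool) → any n P ≡ true → ∃ λ i → P i ≡ true
any-witness (suc n) P found with P zero in P₀
... | true  = zero , P₀
... | false with any-witness n (P ∘ suc) found
...   | i , Pi = suc i , Pi

any-intro : ∀ n (P : Fin n → Bool) i → P i ≡ true → any n P ≡ true
any-intro (suc n) P zero    Pi = ∨-trueˡ (any n (P ∘ suc)) Pi
any-intro (suc n) P (suc i) Pi = ∨-trueʳ (P zero) (any-intro n (P ∘ suc) i Pi)

any-false : ∀ n (P : Fin n → Bool) → any n P ≡ false → ∀ i → P i ≡ false
any-false n P none i with P i in Pi
... | false = refl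
... | true  = ⊥-elim (bit-clash (any-intro n P i Pi) none)

-- An existential holds at most once, but is counted by every witness.
⟦any⟧≤ : ∀ n (P : Fin n → Bool) → ⟦ any n P ⟧ ≤ ∑[ i < n ] ⟦ P i ⟧
⟦any⟧≤ zero    P = z≤n
⟦any⟧≤ (suc n) P = ≤-trans (⟦∨⟧≤ (P zero) _) (+-mono-≤ ≤-refl (⟦any⟧≤ n (P ∘ suc)))

any² : ∀ m n → (Fin m → Fin n → Bool) → Bool
any² m n P = any m (λ i → any n (P i))

any²-witness : ∀ m n (P : Fin m → Fin n → Bool) → any² m n P ≡ true → ∃ λ i → ∃ λ j → P i j ≡ true
any²-witness m n P found with any-witness m _ found
... | i , found-i with any-witness n (P i) found-i
...   | j , Pij = i , j , Pij

any²-intro : ∀ m n (P : Fin m → Fin n → Bool) i j → P i j ≡ true → any² m n P ≡ true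
any²-intro m n P i j Pij = any-intro m _ i (any-intro n (P i) j Pij)

⟦any²⟧≤ : ∀ m n (P : Fin m → Fin n → Bool) → ⟦ any² m n P ⟧ ≤ ∑[ i < m , j < n ] ⟦ P i j ⟧
⟦any²⟧≤ m n P = ≤-trans (⟦any⟧≤ m _) (sum-mono (λ i → ⟦any⟧≤ n (P i)))

does-sound : ∀ {A : Set} (a? : Dec A) → does a? ≡ true → A
does-sound (yes a) _ = a

_==_ : ∀ {n} → Fin n → Fin n → Bool
i == j = does (i ≟ j)

==-refl : ∀ {n} (i : Fin n) → i == i ≡ true
==-refl i = dec-true (i ≟ i) refl

sum-delta : ∀ {n} (c : Fin n) (F : Fin n → ℕ) → ∑[ i < n ] (⟦ i == c ⟧ * F i) ≡ F c
sum-delta {suc n} zero    F =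
  trans (cong₂ _+_ (*-identityˡ (F zero)) (sum-replicate-zero n)) (+-identityʳ (F zero))
sum-delta {suc n} (suc c) F = sum-delta c (F ∘ suc)

∑∑-delta : ∀ {m n} (c : Fin m) (d : Fin n) b → ∑[ i < m , j < n ] ⟦ (i == c ∧ j == d) ∧ b ⟧ ≡ ⟦ b ⟧
∑∑-delta {m} {n} c d b = begin
  ∑[ i < m , j < n ] ⟦ (i == c ∧ j == d) ∧ b ⟧
    ≡⟨ ∑∑-cong (λ i j → trans (cong ⟦_⟧ (∧-assoc (i == c) (j == d) b))
                         (trans (⟦∧⟧ (i == c) _) (cong (⟦ i == c ⟧ *_) (⟦∧⟧ (j == d) b)))) ⟩
  ∑[ i < m , j < n ] (⟦ i == c ⟧ * (⟦ j == d ⟧ * ⟦ b ⟧))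
    ≡⟨ sum-cong-≗ (λ i → ≡.sym (*-distribˡ-sum ⟦ i == c ⟧ (λ j → ⟦ j == d ⟧ * ⟦ b ⟧))) ⟩
  ∑[ i < m ] (⟦ i == c ⟧ * ∑[ j < n ] (⟦ j == d ⟧ * ⟦ b ⟧))
    ≡⟨ sum-cong-≗ (λ i → cong (⟦ i == c ⟧ *_) (sum-delta d (λ _ → ⟦ b ⟧))) ⟩
  ∑[ i < m ] (⟦ i == c ⟧ * ⟦ b ⟧)
    ≡⟨ sum-delta c (λ _ → ⟦ b ⟧) ⟩
  ⟦ b ⟧ ∎
  where open ≡-Reasoning

_∈ᵇ_ : ∀ {k} → Fin k → Subset k → Bool
j ∈ᵇ S = lookup S j

∈ᵇ⇒∈ : ∀ {k} {j : Fin k} {S} → j ∈ᵇ S ≡ true → j ∈ S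
∈ᵇ⇒∈ {j = j} {S} = lookup⇒[]= j S

∈⇒∈ᵇ : ∀ {k} {j : Fin k} {S} → j ∈ S → j ∈ᵇ S ≡ true
∈⇒∈ᵇ = []=⇒lookup

∈ᵇ-tabulate : ∀ {k} (P : Fin k → Bool) j → j ∈ᵇ tabulate P ≡ P j
∈ᵇ-tabulate = lookup∘tabulate

no-bits⇒≡∅ : ∀ {k} {S : Subset k} → (∀ j → j ∈ᵇ S ≡ false) → S ≡ ∅
no-bits⇒≡∅ no-bits = Empty-unique (λ (j , j∈S) → bit-clash (∈⇒∈ᵇ j∈S) (no-bits j))

∣∣-sum : ∀ {k} (S : Subset k) → ∣ S ∣ ≡ ∑[ j < k ] ⟦ j ∈ᵇ S ⟧
∣∣-sum []          = refl
∣∣-sum (true  ∷ S) = cong suc (∣∣-sum S)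
∣∣-sum (false ∷ S) = ∣∣-sum S

weight-sum : ∀ {n k} (f : Fin n → Subset k) → weight f ≡ ∑[ v < n , j < k ] ⟦ j ∈ᵇ f v ⟧
weight-sum {zero}  f = refl
weight-sum {suc n} f = cong₂ _+_ (∣∣-sum (f zero)) (weight-sum (f ∘ suc))

weight-tabulate-∨ : ∀ {n k} (P Q : Fin n → Fin k → Bool) →
  weight (λ v → tabulate (λ j → P v j ∨ Q v j)) ≤ ∑[ v < n , j < k ] (⟦ P v j ⟧ + ⟦ Q v j ⟧)
weight-tabulate-∨ {n} {k} P Q = begin
  weight (λ v → tabulate (λ j → P v j ∨ Q v j))
    ≡⟨ weight-sum (λ v → tabulate (λ j → P v j ∨ Q v j)) ⟩
  ∑[ v < n , j < k ] ⟦ j ∈ᵇ tabulate (λ j → P v j ∨ Q v j) ⟧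
    ≡⟨ ∑∑-cong (λ v j → cong ⟦_⟧ (∈ᵇ-tabulate (λ j → P v j ∨ Q v j) j)) ⟩
  ∑[ v < n , j < k ] ⟦ P v j ∨ Q v j ⟧
    ≤⟨ ∑∑-mono (λ v j → ⟦∨⟧≤ (P v j) (Q v j)) ⟩
  ∑[ v < n , j < k ] (⟦ P v j ⟧ + ⟦ Q v j ⟧) ∎
  where open ≤-Reasoning

only⇒≡⁅⁆ : ∀ {k} {S : Subset k} {i} → i ∈ S → (∀ {j} → j ∈ S → j ≡ i) → S ≡ ⁅ i ⁆
only⇒≡⁅⁆ {S = S} {i} i∈S only = ⊆-antisym
  (λ j∈S → subst (_∈ ⁅ i ⁆) (≡.sym (only j∈S)) (x∈⁅x⁆ i))
  (λ j∈⁅i⁆ → subst (_∈ S) (≡.sym (x∈⁅y⁆⇒x≡y i j∈⁅i⁆)) i∈S)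

only⇒≡∅ : ∀ {k} {S : Subset k} {i} → i ∉ S → (∀ {j} → j ∈ S → j ≡ i) → S ≡ ∅
only⇒≡∅ {S = S} i∉S only = Empty-unique (λ (j , j∈S) → i∉S (subst (_∈ S) (only j∈S) j∈S))

-- Strong total domination: whenever every colour at v equals i (so f v is ∅ or ⁅ i ⁆), the
-- colour i occurs at a neighbour of v.  It yields both clauses of a kRTDF at once.
IsStronglyTotal : ∀ {n} (A : AdjRel n) (k : ℕ) → (Fin n → Subset k) → Set
IsStronglyTotal A k f = ∀ v i → (∀ {j} → j ∈ f v → j ≡ i) → ∃ λ u → A v u × i ∈ f u

stronglyTotal⇒KRTDF : ∀ {n k} {A : AdjRel n} {f : Fin n → Subset k} →
  IsStronglyTotal A k f → IsKRTDF A k f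
stronglyTotal⇒KRTDF total =
  (λ v fv≡∅ i → total v i (λ j∈fv → ⊥-elim (∉⊥ (subst (_ ∈_) fv≡∅ j∈fv)))) ,
  (λ v i fv≡⁅i⁆ → total v i (λ j∈fv → x∈⁅y⁆⇒x≡y i (subst (_ ∈_) fv≡⁅i⁆ j∈fv)))

record Witness {n k} (A : AdjRel n) (R : Fin k → Fin k → Set) (α : Fin n → Subset k)
               (g : Fin n) (j' : Fin k) : Set where
  constructor witness
  field
    vertex   : Fin n
    colour   : Fin k
    colour∈α : colour ∈ α vertex
    link     : (vertex ≡ g × R colour j') ⊎ (A g vertex × colour ≡ j')

neighbour-witness : ∀ {n k} {A : AdjRel n} {R} {α : Fin n → Subset k} {g j'} →
  (∃ λ x → A g x × j' ∈ α x) → Witness A R α g j'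
neighbour-witness {j' = j'} (x , gx , j'∈αx) = witness x j' j'∈αx (inj₂ (gx , refl))

rdf-witness : ∀ {n k} {A : AdjRel n} {α : Fin n → Subset k} →
  IsKRDF A k α → ∀ g j' → Witness A (λ _ _ → ⊤) α g j'
rdf-witness {α = α} α-rdf g j' with nonempty? (α g)
... | yes (j , j∈αg) = witness g j j∈αg (inj₁ (refl , tt))
... | no empty       = neighbour-witness (α-rdf g (Empty-unique empty) j')

-- For a kRTDF α the colour at g can be chosen different from j': if there is none, then
-- α g ⊆ ⁅ j' ⁆ and one of the two kRTDF clauses supplies a neighbour carrying j'.
rtdf-witness : ∀ {n k} {A : AdjRel n} {α : Fin n → Subset k} →
  IsKRTDF A k α → ∀ g j' → Witness A _≢_ α g j'
rtdf-witness {A = A} {α} (α-rdf , α-total) g j' with any? (λ j → (j ∈? α g) ×-dec ¬? (j ≟ j'))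
... | yes (j , j∈αg , j≢j') = witness g j j∈αg (inj₁ (refl , j≢j'))
... | no none = alone (λ {j} j∈αg → decidable-stable (j ≟ j') (λ j≢j' → none (j , j∈αg , j≢j')))
  where
  alone : (∀ {j} → j ∈ α g → j ≡ j') → Witness A _≢_ α g j'
  alone only with j' ∈? α g
  ... | yes j'∈αg = neighbour-witness (α-total g j' (only⇒≡⁅⁆ j'∈αg only))
  ... | no  j'∉αg = neighbour-witness (α-rdf g (only⇒≡∅ j'∉αg only) j')

PairAdj : (G H : Graph) → Fin (n G) × Fin (n H) → Fin (n G) × Fin (n H) → Set
PairAdj G H (g , h) (g' , h') = (g ≡ g' × Adj H h h') ⊎ (h ≡ h' × Adj G g g')

□Adj⇒PairAdj : ∀ (G H : Graph) x y → □Adj G H x y →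
  PairAdj G H (remQuot {n G} (n H) x) (remQuot {n G} (n H) y)
□Adj⇒PairAdj G H x y xy with remQuot {n G} (n H) x | remQuot {n G} (n H) y
... | _ | _ = xy

product-domination : ∀ (G H : Graph) {k} {f : Fin (n G * n H) → Subset k} →
  IsKRDF (□Adj G H) k f → ∀ g h → f (combine g h) ≡ ∅ → ∀ l →
  (∃ λ h' → Adj H h h' × l ∈ f (combine g h')) ⊎ (∃ λ g' → Adj G g g' × l ∈ f (combine g' h))
product-domination G H {f = f} f-rdf g h empty l with f-rdf (combine g h) empty l
... | u , adj , l∈fu = at (remQuot (n H) u) (combine-remQuot (n H) u)
        (subst (λ p → PairAdj G H p (remQuot (n H) u)) (remQuot-combine g h)
               (□Adj⇒PairAdj G H (combine g h) u adj))
  where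
  at : ∀ p → uncurry combine p ≡ u → PairAdj G H (g , h) p →
    (∃ λ h' → Adj H h h' × l ∈ f (combine g h')) ⊎ (∃ λ g' → Adj G g g' × l ∈ f (combine g' h))
  at (g' , h') p≡u (inj₁ (refl , hh')) = inj₁ (h' , hh' , subst (λ z → l ∈ f z) (≡.sym p≡u) l∈fu)
  at (g' , h') p≡u (inj₂ (refl , gg')) = inj₂ (g' , gg' , subst (λ z → l ∈ f z) (≡.sym p≡u) l∈fu)

rotate : ∀ {m} → Fin (2+ m) → Fin (2+ m)
rotate zero    = fromℕ _
rotate (suc j) = inject₁ j

rotate-fpf : ∀ {m} (l : Fin (2+ m)) → rotate l ≢ l
rotate-fpf zero    ()
rotate-fpf (suc j) = inject₁≢suc j
  where
  inject₁≢suc : ∀ {p} (i : Fin (suc p)) → inject₁ i ≢ suc i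
  inject₁≢suc zero    ()
  inject₁≢suc {suc p} (suc i) eq = inject₁≢suc i (suc-injective eq)

rotate-onto : ∀ {m} (l : Fin (2+ m)) → ∃ λ l₀ → rotate l₀ ≡ l
rotate-onto l with view l
... | ‵fromℕ  = zero , refl
... | ‵inj₁ {i = j} _ = suc j , refl

sum-rotate : ∀ {m} (F : Fin (2+ m) → ℕ) → ∑[ l < 2+ m ] F (rotate l) ≡ sum F
sum-rotate F = trans (+-comm (F (rotate zero)) _) (≡.sym (sum-init-last F))

module Construction
  (G H : Graph) (m : ℕ) (adj? : ∀ u v → Dec (Adj G u v))
  (α : Fin (n G) → Subset (2+ m))
  (f : Fin (n G * n H) → Subset (2+ m)) (f-rdf : IsKRDF (□Adj G H) (2+ m) f)
  {R : Fin (2+ m) → Fin (2+ m) → Set} (π : ∀ g j' → Witness (Adj G) R α g j')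
  where

  open Witness

  k : ℕ
  k = 2+ m

  nG : ℕ
  nG = n G

  nH : ℕ
  nH = n H

  has : Fin nG → Fin nH → Fin k → Bool
  has g h l = l ∈ᵇ f (combine g h)

  adj : Fin nG → Fin nG → Bool
  adj g g' = does (adj? g g')

  near : Fin nG → Fin nH → Fin k → Fin nG → Bool
  near g h l g' = adj g g' ∧ has g' h l

  seen : Fin nG → Fin nH → Fin k → Bool
  seen g h l = has g h l ∨ any nG (near g h l)

  points : Fin nG → Fin k → Fin nG → Fin k → Bool
  points g j' x j = x == vertex (π g j') ∧ j == colour (π g j')

  blind : Fin nG → Fin k → Fin nH → Fin k → Fin nG → Fin k → Bool
  blind x j h l g j' = points g j' x j ∧ not (seen g h l)

  bad : Fin nG → Fin k → Fin nH → Fin k → Bool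
  bad x j h l = any² nG k (blind x j h l)

  carrier : Fin nG → Fin k → Fin nH → Fin k → Fin nG → Fin k → Bool
  carrier x j h l g j' = points g j' x j ∧ has g h l

  hit : Fin nG → Fin k → Fin nH → Fin k → Bool
  hit x j h l = any² nG k (carrier x j h l)

  β : Fin nH → Fin k → Fin nG → Subset k
  β h l g = tabulate (λ j → has g h l ∨ (j ∈ᵇ α g ∧ bad g j h l))

  ψ : Fin nG → Fin k → Fin nH → Subset k
  ψ x j h = tabulate (λ l → hit x j h l ∨ not (bad x j h (rotate l)))

  ∈β : ∀ h l g j → has g h l ∨ (j ∈ᵇ α g ∧ bad g j h l) ≡ true → j ∈ β h l g
  ∈β h l g j set = ∈ᵇ⇒∈ (trans (∈ᵇ-tabulate (λ j → has g h l ∨ (j ∈ᵇ α g ∧ bad g j h l)) j) set)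

  ∈ψ : ∀ x j h l → hit x j h l ∨ not (bad x j h (rotate l)) ≡ true → l ∈ ψ x j h
  ∈ψ x j h l set = ∈ᵇ⇒∈ (trans (∈ᵇ-tabulate (λ l → hit x j h l ∨ not (bad x j h (rotate l))) l) set)

  points-self : ∀ g j' → points g j' (vertex (π g j')) (colour (π g j')) ≡ true
  points-self g j' = cong₂ _∧_ (==-refl (vertex (π g j'))) (==-refl (colour (π g j')))

  unseen : ∀ g h l → seen g h l ≡ false → has g h l ≡ false × (∀ g' → Adj G g g' → has g' h l ≡ false)
  unseen g h l unseen-l = ∨-conicalˡ (has g h l) _ unseen-l , absent
    where
    absent : ∀ g' → Adj G g g' → has g' h l ≡ false
    absent g' gg' = trans (≡.sym (cong (_∧ has g' h l) (dec-true (adj? g g') gg')))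
                          (any-false nG (near g h l) (∨-conicalʳ (has g h l) _ unseen-l) g')

  unseen-in-fibre : ∀ g h l → seen g h l ≡ false →
    (∃ λ l' → has g h l' ≡ true) ⊎ (∃ λ h' → Adj H h h' × has g h' l ≡ true)
  unseen-in-fibre g h l unseen-l with any k (has g h) in occupied
  ... | true  = inj₁ (any-witness k (has g h) occupied)
  ... | false with product-domination G H f-rdf g h (no-bits⇒≡∅ (any-false k (has g h) occupied)) l
  ...   | inj₁ (h' , hh' , l∈) = inj₂ (h' , hh' , ∈⇒∈ᵇ l∈)
  ...   | inj₂ (g' , gg' , l∈) = ⊥-elim (bit-clash (∈⇒∈ᵇ l∈) (proj₂ (unseen g h l unseen-l) g' gg'))

  bad-at-witness : ∀ g j' h l → seen g h l ≡ false →
    bad (vertex (π g j')) (colour (π g j')) h l ≡ true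
  bad-at-witness g j' h l unseen-l =
    any²-intro nG k (blind (vertex (π g j')) (colour (π g j')) h l) g j'
      (cong₂ _∧_ (points-self g j') (cong not unseen-l))

  bad-witness : ∀ x j h l → bad x j h l ≡ true →
    ∃ λ g → ∃ λ j' → points g j' x j ≡ true × seen g h l ≡ false
  bad-witness x j h l is-bad with any²-witness nG k (blind x j h l) is-bad
  ... | g , j' , p =
    g , j' , ∧-conicalˡ (points g j' x j) _ p , not-injective (∧-conicalʳ _ (not (seen g h l)) p)

  hit-intro : ∀ g j' x j h l → points g j' x j ≡ true → has g h l ≡ true → hit x j h l ≡ true
  hit-intro g j' x j h l p q = any²-intro nG k (carrier x j h l) g j' (cong₂ _∧_ p q)

  -- A colour l' at (g, h) would be hit, so l' = l,
  -- which is unseen; hence l occurs at an H-neighbour (g, h'), where it is hit.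
  ψ-bad : ∀ x j h l → (∀ {l'} → l' ∈ ψ x j h → l' ≡ l) → bad x j h l ≡ true →
    ∃ λ h' → Adj H h h' × l ∈ ψ x j h'
  ψ-bad x j h l only l-bad with bad-witness x j h l l-bad
  ... | g , j' , p , unseen-l with unseen-in-fibre g h l unseen-l
  ...   | inj₂ (h' , hh' , q) = h' , hh' , ∈ψ x j h' l (∨-trueˡ _ (hit-intro g j' x j h' l p q))
  ...   | inj₁ (l' , q) = ⊥-elim (bit-clash (subst (λ i → has g h i ≡ true) l'≡l q)
                                              (proj₁ (unseen g h l unseen-l)))
    where
    l'≡l : l' ≡ l
    l'≡l = only (∈ψ x j h l' (∨-trueˡ _ (hit-intro g j' x j h l' p q)))

  -- If every colour of ψ(x,j) at h equals l, then (h, l) is bad: otherwise the colour l₀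
  -- rotated onto l lies in ψ(x,j)(h), so l₀ = l and the rotation would fix l.
  ψ-small⇒bad : ∀ x j h l → (∀ {l'} → l' ∈ ψ x j h → l' ≡ l) → bad x j h l ≡ true
  ψ-small⇒bad x j h l only = ¬-not good⇒fixed-point
    where
    good⇒fixed-point : bad x j h l ≢ false
    good⇒fixed-point l-good with rotate-onto l
    ... | l₀ , σl₀≡l = rotate-fpf l (trans (cong rotate (≡.sym l₀≡l)) σl₀≡l)
      where
      l₀≡l : l₀ ≡ l
      l₀≡l = only (∈ψ x j h l₀ (∨-trueʳ _ (cong not (trans (cong (bad x j h) σl₀≡l) l-good))))

  ψ-strong : ∀ x j → IsStronglyTotal (Adj H) k (ψ x j)
  ψ-strong x j h l only = ψ-bad x j h l only (ψ-small⇒bad x j h l only)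

  carrier∈β : ∀ h l u j → has u h l ≡ true → j ∈ β h l u
  carrier∈β h l u j l∈u = ∈β h l u j (∨-trueˡ _ l∈u)

  bad-colour∈β : ∀ h l x j → j ∈ α x → bad x j h l ≡ true → j ∈ β h l x
  bad-colour∈β h l x j j∈αx x-bad = ∈β h l x j (∨-trueʳ _ (cong₂ _∧_ (∈⇒∈ᵇ j∈αx) x-bad))

  β-small⇒l∉ : ∀ h l v j₀ → (∀ {j} → j ∈ β h l v → j ≡ j₀) → has v h l ≡ false
  β-small⇒l∉ h l v j₀ only = ¬-not (λ l∈v → rotate-fpf j₀ (only (carrier∈β h l v (rotate j₀) l∈v)))

  seen-nearby : ∀ v h l → has v h l ≡ false → seen v h l ≡ true → ∃ λ u → Adj G v u × has u h l ≡ true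
  seen-nearby v h l l∉v v-sees
    with any-witness nG (near v h l) (trans (cong (_∨ any nG (near v h l)) (≡.sym l∉v)) v-sees)
  ... | u , vu = u , does-sound (adj? v u) (∧-conicalˡ _ _ vu) , ∧-conicalʳ (adj v u) _ vu

  -- If v sees l, a G-neighbour carries l and hence every colour.  Otherwise the
  -- witness (x, j) of (v, j') is bad at (h, l), so j ∈ β(h,l)(x); by the hypothesis x ≠ v, so
  -- x is a neighbour of v and j = j'.
  β-dom : ∀ h l v j' → has v h l ≡ false → (∀ {j} → R j j' → j ∉ β h l v) →
    ∃ λ u → Adj G v u × j' ∈ β h l u
  β-dom h l v j' l∉v no-R with seen v h l in v-sees
  ... | true with seen-nearby v h l l∉v v-sees
  ...   | u , vu , l∈u = u , vu , carrier∈β h l u j' l∈u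
  β-dom h l v j' l∉v no-R | false with π v j' | bad-at-witness v j' h l v-sees
  ... | witness x j j∈αx (inj₁ (refl , r)) | x-bad = ⊥-elim (no-R r (bad-colour∈β h l x j j∈αx x-bad))
  ... | witness x j j∈αx (inj₂ (vx , refl)) | x-bad = x , vx , bad-colour∈β h l x j j∈αx x-bad

  -- β(h, l) is a kRDF: at an empty vertex no colour is R-related to anything.
  β-rdf : ∀ h l → IsKRDF (Adj G) k (β h l)
  β-rdf h l v empty j' = β-dom h l v j' (β-small⇒l∉ h l v j' (⊥-elim ∘ ∉∅)) (λ _ → ∉∅)
    where
    ∉∅ : ∀ {j} → j ∉ β h l v
    ∉∅ {j} j∈ = ∉⊥ (subst (j ∈_) empty j∈)

  -- For irreflexive R (the total case, where colours chosen at g itself differ from j'),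
  -- β(h, l) is strongly total.
  β-strong : (∀ {j} → ¬ R j j) → ∀ h l → IsStronglyTotal (Adj G) k (β h l)
  β-strong R-irrefl h l v j' only =
    β-dom h l v j' (β-small⇒l∉ h l v j' only) (λ r j∈ → R-irrefl (subst (λ i → R i j') (only j∈) r))

  weight-f : weight f ≡ ∑[ g < nG ] ∑[ h < nH , l < k ] ⟦ has g h l ⟧
  weight-f = trans (weight-sum f) (sum-combine nG nH (λ x → ∑[ l < k ] ⟦ l ∈ᵇ f x ⟧))

  colour-copies : ∑[ g < nG , j' < k ] ∑[ h < nH , l < k ] ⟦ has g h l ⟧ ≡ k * weight f
  colour-copies = begin
    ∑[ g < nG ] ∑[ j' < k ] fibre g  ≡⟨ sum-cong-≗ (λ g → sum-const k (fibre g)) ⟩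
    ∑[ g < nG ] (k * fibre g)        ≡⟨ ≡.sym (*-distribˡ-sum k fibre) ⟩
    k * sum fibre                    ≡⟨ cong (k *_) (≡.sym weight-f) ⟩
    k * weight f                     ∎
    where
    open ≡-Reasoning
    fibre : Fin nG → ℕ
    fibre g = ∑[ h < nH , l < k ] ⟦ has g h l ⟧

  weight-β : ∀ h l → weight (β h l) ≤ ∑[ g < nG , j < k ] (⟦ has g h l ⟧ + ⟦ j ∈ᵇ α g ∧ bad g j h l ⟧)
  weight-β h l = weight-tabulate-∨ (λ g j → has g h l) (λ g j → j ∈ᵇ α g ∧ bad g j h l)

  hits : Fin nG → Fin k → ℕ
  hits x j = ∑[ h < nH , l < k ] ⟦ hit x j h l ⟧

  -- The rotation does not change the number of good pairs (h, l).
  weight-ψ : ∀ x j → weight (ψ x j) ≤ hits x j + ∑[ h < nH , l < k ] ⟦ not (bad x j h l) ⟧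
  weight-ψ x j = begin
    weight (ψ x j)
      ≤⟨ weight-tabulate-∨ (hit x j) (λ h l → not (bad x j h (rotate l))) ⟩
    ∑[ h < nH , l < k ] (⟦ hit x j h l ⟧ + ⟦ not (bad x j h (rotate l)) ⟧)
      ≡⟨ ∑∑-distrib-+ (λ h l → ⟦ hit x j h l ⟧) (λ h l → ⟦ not (bad x j h (rotate l)) ⟧) ⟩
    hits x j + ∑[ h < nH , l < k ] ⟦ not (bad x j h (rotate l)) ⟧
      ≡⟨ cong (hits x j +_) (sum-cong-≗ (λ h → sum-rotate (λ l → ⟦ not (bad x j h l) ⟧))) ⟩
    hits x j + ∑[ h < nH , l < k ] ⟦ not (bad x j h l) ⟧ ∎
    where open ≤-Reasoning

  -- Every (g, j') points to exactly one (x, j), so in total each colour copy is hit at most once.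
  hits-bound : ∑[ x < nG , j < k ] hits x j ≤ k * weight f
  hits-bound = begin
    ∑[ x < nG , j < k ] ∑[ h < nH , l < k ] ⟦ hit x j h l ⟧
      ≤⟨ ∑∑-mono (λ x j → ∑∑-mono (λ h l → ⟦any²⟧≤ nG k (carrier x j h l))) ⟩
    ∑[ x < nG , j < k ] ∑[ h < nH , l < k ] ∑[ g < nG , j' < k ] ⟦ carrier x j h l g j' ⟧
      ≡⟨ ∑∑-cong (λ x j → ∑∑-comm (λ h l g j' → ⟦ carrier x j h l g j' ⟧)) ⟩
    ∑[ x < nG , j < k ] ∑[ g < nG , j' < k ] ∑[ h < nH , l < k ] ⟦ carrier x j h l g j' ⟧
      ≡⟨ ∑∑-comm (λ x j g j' → ∑[ h < nH , l < k ] ⟦ carrier x j h l g j' ⟧) ⟩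
    ∑[ g < nG , j' < k ] ∑[ x < nG , j < k ] ∑[ h < nH , l < k ] ⟦ carrier x j h l g j' ⟧
      ≡⟨ ∑∑-cong (λ g j' → ∑∑-comm (λ x j h l → ⟦ carrier x j h l g j' ⟧)) ⟩
    ∑[ g < nG , j' < k ] ∑[ h < nH , l < k ] ∑[ x < nG , j < k ] ⟦ carrier x j h l g j' ⟧
      ≡⟨ ∑∑-cong (λ g j' → ∑∑-cong (λ h l →
           ∑∑-delta (vertex (π g j')) (colour (π g j')) (has g h l))) ⟩
    ∑[ g < nG , j' < k ] ∑[ h < nH , l < k ] ⟦ has g h l ⟧
      ≡⟨ colour-copies ⟩
    k * weight f ∎
    where open ≤-Reasoning

  T₁ : ℕ
  T₁ = ∑[ x < nG , j < k ] ∑[ h < nH , l < k ] ⟦ j ∈ᵇ α x ∧ bad x j h l ⟧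

  T₂ : ℕ
  T₂ = ∑[ x < nG , j < k ] ∑[ h < nH , l < k ] ⟦ j ∈ᵇ α x ∧ not (bad x j h l) ⟧

  T₁+T₂ : T₁ + T₂ ≡ nH * (k * weight α)
  T₁+T₂ = begin
    T₁ + T₂
      ≡⟨ ≡.sym (∑∑-distrib-+ (λ x j → ∑∑ nH k (λ h l → ⟦ j ∈ᵇ α x ∧ bad x j h l ⟧))
                              (λ x j → ∑∑ nH k (λ h l → ⟦ j ∈ᵇ α x ∧ not (bad x j h l) ⟧))) ⟩
    ∑[ x < nG , j < k ] (∑∑ nH k (λ h l → ⟦ j ∈ᵇ α x ∧ bad x j h l ⟧)
                         + ∑∑ nH k (λ h l → ⟦ j ∈ᵇ α x ∧ not (bad x j h l) ⟧))
      ≡⟨ ∑∑-cong (λ x j → ≡.sym (∑∑-distrib-+ (λ h l → ⟦ j ∈ᵇ α x ∧ bad x j h l ⟧)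
                                               (λ h l → ⟦ j ∈ᵇ α x ∧ not (bad x j h l) ⟧))) ⟩
    ∑[ x < nG , j < k ] ∑[ h < nH , l < k ]
      (⟦ j ∈ᵇ α x ∧ bad x j h l ⟧ + ⟦ j ∈ᵇ α x ∧ not (bad x j h l) ⟧)
      ≡⟨ ∑∑-cong (λ x j → ∑∑-cong (λ h l → ⟦∧⟧-split (j ∈ᵇ α x) (bad x j h l))) ⟩
    ∑[ x < nG , j < k ] ∑[ h < nH , l < k ] ⟦ j ∈ᵇ α x ⟧
      ≡⟨ ∑∑-cong (λ x j → ∑∑-const nH k ⟦ j ∈ᵇ α x ⟧) ⟩
    ∑[ x < nG , j < k ] (nH * (k * ⟦ j ∈ᵇ α x ⟧))
      ≡⟨ ≡.sym (∑∑-distribˡ nH (λ x j → k * ⟦ j ∈ᵇ α x ⟧)) ⟩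
    nH * ∑[ x < nG , j < k ] (k * ⟦ j ∈ᵇ α x ⟧)
      ≡⟨ cong (nH *_) (≡.sym (∑∑-distribˡ k (λ x j → ⟦ j ∈ᵇ α x ⟧))) ⟩
    nH * (k * ∑[ x < nG , j < k ] ⟦ j ∈ᵇ α x ⟧)
      ≡⟨ cong (λ w → nH * (k * w)) (≡.sym (weight-sum α)) ⟩
    nH * (k * weight α) ∎
    where open ≡-Reasoning

  count-G : ∀ {a} → (∀ h l → a ≤ weight (β h l)) → nH * (k * a) ≤ k * weight f + T₁
  count-G {a} a≤β = begin
    nH * (k * a)
      ≡⟨ ≡.sym (∑∑-const nH k a) ⟩
    ∑[ h < nH , l < k ] a
      ≤⟨ ∑∑-mono (λ h l → ≤-trans (a≤β h l) (weight-β h l)) ⟩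
    ∑[ h < nH , l < k ] ∑[ g < nG , j < k ] (⟦ has g h l ⟧ + ⟦ j ∈ᵇ α g ∧ bad g j h l ⟧)
      ≡⟨ ∑∑-comm (λ h l g j → ⟦ has g h l ⟧ + ⟦ j ∈ᵇ α g ∧ bad g j h l ⟧) ⟩
    ∑[ g < nG , j < k ] ∑[ h < nH , l < k ] (⟦ has g h l ⟧ + ⟦ j ∈ᵇ α g ∧ bad g j h l ⟧)
      ≡⟨ ∑∑-cong (λ g j → ∑∑-distrib-+ (λ h l → ⟦ has g h l ⟧) (λ h l → ⟦ j ∈ᵇ α g ∧ bad g j h l ⟧)) ⟩
    ∑[ g < nG , j < k ]
      (∑∑ nH k (λ h l → ⟦ has g h l ⟧) + ∑∑ nH k (λ h l → ⟦ j ∈ᵇ α g ∧ bad g j h l ⟧))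
      ≡⟨ ∑∑-distrib-+ (λ g j → ∑∑ nH k (λ h l → ⟦ has g h l ⟧))
                      (λ g j → ∑∑ nH k (λ h l → ⟦ j ∈ᵇ α g ∧ bad g j h l ⟧)) ⟩
    ∑[ g < nG , j < k ] ∑[ h < nH , l < k ] ⟦ has g h l ⟧ + T₁
      ≡⟨ cong (_+ T₁) colour-copies ⟩
    k * weight f + T₁ ∎
    where open ≤-Reasoning

  count-H-at : ∀ {b} x j → b ≤ weight (ψ x j) →
    ⟦ j ∈ᵇ α x ⟧ * b ≤ hits x j + ∑[ h < nH , l < k ] ⟦ j ∈ᵇ α x ∧ not (bad x j h l) ⟧
  count-H-at {b} x j b≤ψ = begin
    ⟦ j∈α ⟧ * b
      ≤⟨ *-monoʳ-≤ ⟦ j∈α ⟧ (≤-trans b≤ψ (weight-ψ x j)) ⟩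
    ⟦ j∈α ⟧ * (hits x j + ∑∑ nH k good)
      ≤⟨ ⟦⟧*-absorb j∈α (hits x j) (∑∑ nH k good) ⟩
    hits x j + ⟦ j∈α ⟧ * ∑∑ nH k good
      ≡⟨ cong (hits x j +_) (∑∑-distribˡ ⟦ j∈α ⟧ good) ⟩
    hits x j + ∑[ h < nH , l < k ] (⟦ j∈α ⟧ * ⟦ not (bad x j h l) ⟧)
      ≡⟨ cong (hits x j +_) (∑∑-cong (λ h l → ≡.sym (⟦∧⟧ j∈α (not (bad x j h l))))) ⟩
    hits x j + ∑[ h < nH , l < k ] ⟦ j∈α ∧ not (bad x j h l) ⟧ ∎
    where
    open ≤-Reasoning
    j∈α : Bool
    j∈α = j ∈ᵇ α x
    good : Fin nH → Fin k → ℕ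
    good h l = ⟦ not (bad x j h l) ⟧

  count-H : ∀ {b} → (∀ x j → b ≤ weight (ψ x j)) → weight α * b ≤ k * weight f + T₂
  count-H {b} b≤ψ = begin
    weight α * b
      ≡⟨ cong (_* b) (weight-sum α) ⟩
    ∑[ x < nG , j < k ] ⟦ j ∈ᵇ α x ⟧ * b
      ≡⟨ ∑∑-distribʳ b (λ x j → ⟦ j ∈ᵇ α x ⟧) ⟩
    ∑[ x < nG , j < k ] (⟦ j ∈ᵇ α x ⟧ * b)
      ≤⟨ ∑∑-mono (λ x j → count-H-at x j (b≤ψ x j)) ⟩
    ∑[ x < nG , j < k ] (hits x j + ∑∑ nH k (λ h l → ⟦ j ∈ᵇ α x ∧ not (bad x j h l) ⟧))
      ≡⟨ ∑∑-distrib-+ hits (λ x j → ∑∑ nH k (λ h l → ⟦ j ∈ᵇ α x ∧ not (bad x j h l) ⟧)) ⟩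
    ∑[ x < nG , j < k ] hits x j + T₂
      ≤⟨ +-monoˡ-≤ T₂ hits-bound ⟩
    k * weight f + T₂ ∎
    where open ≤-Reasoning

  rainbow-bound : ∀ {b} → (∀ h l → weight α ≤ weight (β h l)) → (∀ x j → b ≤ weight (ψ x j)) →
    weight α * b ≤ 2 * k * weight f
  rainbow-bound {b} α≤β b≤ψ =
    +-cancelʳ-≤ (nH * (k * weight α)) (weight α * b) (2 * k * weight f) (begin
    weight α * b + nH * (k * weight α)
      ≤⟨ +-mono-≤ (count-H b≤ψ) (count-G α≤β) ⟩
    (k * weight f + T₂) + (k * weight f + T₁)
      ≡⟨ regroup k (weight f) T₂ T₁ ⟩
    2 * k * weight f + (T₁ + T₂)
      ≡⟨ cong (2 * k * weight f +_) T₁+T₂ ⟩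
    2 * k * weight f + nH * (k * weight α) ∎)
    where
    open ≤-Reasoning
    regroup : ∀ p c q r → (p * c + q) + (p * c + r) ≡ 2 * p * c + (r + q)
    regroup = solve-∀

¬¬-∀-Fin : ∀ n {P : Fin n → Set} → (∀ i → ¬ ¬ P i) → ¬ ¬ (∀ i → P i)
¬¬-∀-Fin zero    ¬¬P ¬∀P = ¬∀P (λ ())
¬¬-∀-Fin (suc n) ¬¬P ¬∀P =
  ¬¬P zero (λ P₀ → ¬¬-∀-Fin n (¬¬P ∘ suc) (λ P₊ → ¬∀P (λ { zero → P₀ ; (suc i) → P₊ i })))

-- Adjacency of a graph is decidable up to double negation, so a decidable goal may be proved
-- assuming it.  (The adjacency relation of Graph is an arbitrary type family.)
with-decidable-adjacency : (G : Graph) {P : Set} → Dec P → ((∀ u v → Dec (Adj G u v)) → P) → P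
with-decidable-adjacency G P? use = decidable-stable P? (λ ¬P → decidable-adjacency (¬P ∘ use))
  where
  decidable-adjacency : ¬ ¬ (∀ u v → Dec (Adj G u v))
  decidable-adjacency = ¬¬-∀-Fin (n G) (λ u → ¬¬-∀-Fin (n G) (λ v → ¬¬-excluded-middle))

proposition15 : (G H : Graph) (k : ℕ) → 2 ≤ k →
    (∀ a b c → IsRainbowTotalDomNum (Adj G) k a → IsRainbowTotalDomNum (Adj H) k b →
      IsRainbowTotalDomNum (□Adj G H) k c → a * b ≤ 2 * k * c)
    × (∀ a b c → IsRainbowDomNum (Adj G) k a → IsRainbowDomNum (Adj H) k b →
      IsRainbowDomNum (□Adj G H) k c → a * b ≤ 2 * k * c)
proposition15 G H (2+ m) (s≤s (s≤s z≤n)) = total , plain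
  where
  total : ∀ a b c → IsRainbowTotalDomNum (Adj G) (2+ m) a → IsRainbowTotalDomNum (Adj H) (2+ m) b →
    IsRainbowTotalDomNum (□Adj G H) (2+ m) c → a * b ≤ 2 * (2+ m) * c
  total _ b _ ((α , α-rtdf , refl) , minimal-G) (_ , minimal-H) ((f , f-rtdf , refl) , _) =
    with-decidable-adjacency G (_ ≤? _) λ adj? →
      let open Construction G H m adj? α f (proj₁ f-rtdf) (rtdf-witness α-rtdf)
      in rainbow-bound
           (λ h l → minimal-G (β h l) (stronglyTotal⇒KRTDF (β-strong (λ j≢j → j≢j refl) h l)))
           (λ x j → minimal-H (ψ x j) (stronglyTotal⇒KRTDF (ψ-strong x j)))

  plain : ∀ a b c → IsRainbowDomNum (Adj G) (2+ m) a → IsRainbowDomNum (Adj H) (2+ m) b →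
    IsRainbowDomNum (□Adj G H) (2+ m) c → a * b ≤ 2 * (2+ m) * c
  plain _ b _ ((α , α-rdf , refl) , minimal-G) (_ , minimal-H) ((f , f-rdf , refl) , _) =
    with-decidable-adjacency G (_ ≤? _) λ adj? →
      let open Construction G H m adj? α f f-rdf (rdf-witness α-rdf)
      in rainbow-bound
           (λ h l → minimal-G (β h l) (β-rdf h l))
           (λ x j → minimal-H (ψ x j) (proj₁ (stronglyTotal⇒KRTDF (ψ-strong x j))))
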